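{- Let $M=(S,I,R,L)$ be a finite Kripke structure, let $i,j,j'$ be indices, and let $v$ be a Boolean assignment to the propositional variables $x_{i,\mathsf{EU}}, l_{i,j}, r_{i,j'}$, $y^M_{j,s}, y^M_{j',s}, y^M_{i,s}$ ($s\in S$) and $y^M_{i,s,k}$ ($s\in S$, $k\in\{1,\dots,|S|+1\}$) which satisfies the propositional formula $$[x_{i,\mathsf{EU}}\wedge l_{i,j}\wedge r_{i,j'}]\rightarrow\bigwedge_{s\in S}\Big[\big[y^M_{i,s,1}\leftrightarrow y^M_{j',s}\big]\wedge\bigwedge_{1\le k\le|S|}\big[y^M_{i,s,k+1}\leftrightarrow\big(y^M_{i,s,k}\vee\big(y^M_{j,s}\wedge\textstyle\bigvee_{s'\in\mathrm{post}(s)}y^M_{i,s',k}\big)\big)\big]\wedge\big[y^M_{i,s}\leftrightarrow y^M_{i,s,|S|+1}\big]\Big]$$ and such that $v(x_{i,\mathsf{EU}})=1$, $v(l_{i,j})=1$ and $v(r_{i,j'})=1$. Then for every state $s\in S$ and every $k\in\{1,\dots,|S|+1\}$: $v(y^M_{i,s,k})=1$ if and only if there exists a path prefix $s_0s_1\dots s_t$ of $M$ with $s_0=s$ and $0\le t<k$ such that $v(y^M_{j,\bar s})=1$ for all $\bar s\in\{s_0,\dots,s_{t-1}\}$ and $v(y^M_{j',s_t})=1$.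
   Context: A Kripke structure $M=(S,I,R,L)$ has a set of states $S$, initial states $I\subseteq S$, a transition relation $R\subseteq S\times S$ in which every state has a successor, and a labeling $L$; $\mathrm{post}(s)=\{s'\in S\mid (s,s')\in R\}$. A path prefix is a finite sequence of states $s_0s_1\dots s_t$ with $s_{m+1}\in\mathrm{post}(s_m)$ for all $0\le m<t$. Propositional variables take values in $\{0,1\}$ and $v$ satisfies a formula in the usual sense. -}

module Defs where

open import Data.Nat using (ℕ; zero; suc; _<_)
open import Data.Fin using (Fin; inject₁; fromℕ) renaming (suc to fsuc)
open import Data.Bool using (Bool; true; false; _∧_; _∨_; not)
open import Data.List using (List; map; foldr; allFin; filterᵇ; upTo)
open import Data.Product using (Σ; ∃; _×_)
open import Relation.Binary.PropositionalEquality using (_≡_)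

record Kripke (AP : Set) : Set₁ where
  field
    n     : ℕ
    I     : Fin n → Bool
    R     : Fin n → Fin n → Bool
    total : ∀ s → ∃ λ s' → R s s' ≡ true
    L     : Fin n → AP → Bool
  State : Set
  State = Fin n
  post : State → List State
  post s = filterᵇ (R s) (allFin n)
open Kripke public

data Var (n : ℕ) : Set where
  xEU : ℕ → Var n
  l   : ℕ → ℕ → Var n
  r   : ℕ → ℕ → Var n
  y   : ℕ → Fin n → Var n
  yk  : ℕ → Fin n → ℕ → Var n

data Form (V : Set) : Set where
  var  : V → Form V
  ⊤ᶠ ⊥ᶠ : Form V
  _∧ᶠ_ _∨ᶠ_ _⇒ᶠ_ _⇔ᶠ_ : Form V → Form V → Form V

⟦_⟧ : ∀ {V} → Form V → (V → Bool) → Bool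
⟦ var x ⟧ v = v x
⟦ ⊤ᶠ ⟧ v = true
⟦ ⊥ᶠ ⟧ v = false
⟦ φ ∧ᶠ ψ ⟧ v = ⟦ φ ⟧ v ∧ ⟦ ψ ⟧ v
⟦ φ ∨ᶠ ψ ⟧ v = ⟦ φ ⟧ v ∨ ⟦ ψ ⟧ v
⟦ φ ⇒ᶠ ψ ⟧ v = not (⟦ φ ⟧ v) ∨ ⟦ ψ ⟧ v
⟦ φ ⇔ᶠ ψ ⟧ v with ⟦ φ ⟧ v | ⟦ ψ ⟧ v
... | true  | true  = true
... | false | false = true
... | _     | _     = false

⋀ ⋁ : ∀ {V} → List (Form V) → Form V
⋀ = foldr _∧ᶠ_ ⊤ᶠ
⋁ = foldr _∨ᶠ_ ⊥ᶠ

_⊨_ : ∀ {V} → (V → Bool) → Form V → Set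
v ⊨ φ = ⟦ φ ⟧ v ≡ true

euFormula : ∀ {AP} (M : Kripke AP) (i j j' : ℕ) → Form (Var (n M))
euFormula M i j j' =
  (var (xEU i) ∧ᶠ (var (l i j) ∧ᶠ var (r i j')))
  ⇒ᶠ ⋀ (map perState (allFin (n M)))
  where
  N = n M
  perState : Fin N → Form (Var N)
  perState s =
    (var (yk i s 1) ⇔ᶠ var (y j' s))
    ∧ᶠ (⋀ (map (λ k' → let k = suc k' in
                 var (yk i s (suc k)) ⇔ᶠ
                   (var (yk i s k) ∨ᶠ
                     (var (y j s) ∧ᶠ ⋁ (map (λ s' → var (yk i s' k)) (post M s)))))
               (upTo N))                      -- k ranges over 1..|S|
       ∧ᶠ (var (y i s) ⇔ᶠ var (yk i s (suc N))))

record PathPrefix {AP} (M : Kripke AP) : Set where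
  field
    t     : ℕ
    st    : Fin (suc t) → Fin (n M)
    step  : ∀ (m : Fin t) → R M (st (inject₁ m)) (st (fsuc m)) ≡ true
open PathPrefix public

lastSt : ∀ {AP} {M : Kripke AP} → (p : PathPrefix M) → Fin (n M)
lastSt p = st p (fromℕ (t p))

{-# OPTIONS --safe #-}
module Submission where

-- Call a state good within k if some path prefix from it with fewer than k edges satisfies
-- a until its last state, which satisfies b. Splitting a prefix at its first edge shows that
-- being good within k + 2 means: good within k + 1, or a holds here and some successor is
-- good within k + 1; and being good within 1 means b holds. The formula imposes exactly this
-- recurrence on the y_{i,s,k}, so induction on k identifies the two.

open import Defs
open import Data.Nat using (ℕ; zero; suc; _≤_; _<_; z≤n; s≤s)
open import Data.Nat.Properties using (≤-trans; n≤1+n)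
open import Data.Fin using (Fin; zero; inject₁) renaming (suc to fsuc)
open import Data.Bool using (Bool; true; false; _∧_; _∨_)
open import Data.Bool.Properties using (T-≡)
open import Data.List using ([]; _∷_; map; allFin; upTo)
open import Data.List.Relation.Unary.All using (All; []; _∷_; lookup)
import Data.List.Relation.Unary.All.Properties as All
open import Data.List.Relation.Unary.Any using (Any; here; there)
import Data.List.Relation.Unary.Any.Properties as Any
open import Data.List.Membership.Propositional using (_∈_; find; lose)
open import Data.List.Membership.Propositional.Properties using (∈-allFin; ∈-filter⁺; ∈-filter⁻; ∈-upTo⁺)
open import Data.Product using (∃; _×_; _,_; proj₁; proj₂)
open import Data.Product.Function.NonDependent.Propositional using (_×-⇔_)
open import Data.Sum using (_⊎_; inj₁; inj₂; [_,_])
open import Data.Sum.Function.Propositional using (_⊎-⇔_)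
open import Function using (_∘_)
open import Function.Bundles using (_⇔_; mk⇔; Equivalence)
open import Function.Properties.Equivalence using () renaming (refl to ⇔-refl; sym to ⇔-sym; trans to ⇔-trans)
open import Function.Properties.Inverse using (↔⇒⇔)
open import Function.Related.Propositional using (module EquationalReasoning)
open import Relation.Binary.PropositionalEquality using (_≡_; refl)
open import Relation.Nullary.Decidable using (T?)

open Equivalence using (to; from)

∧-≡-true : ∀ {x y} → x ∧ y ≡ true ⇔ (x ≡ true × y ≡ true)
∧-≡-true {true}  = mk⇔ (refl ,_) proj₂
∧-≡-true {false} = mk⇔ (λ ()) proj₁

∨-≡-true : ∀ {x y} → x ∨ y ≡ true ⇔ (x ≡ true ⊎ y ≡ true)
∨-≡-true {true}           = mk⇔ inj₁ (λ _ → refl)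
∨-≡-true {false} {true}   = mk⇔ inj₂ (λ _ → refl)
∨-≡-true {false} {false}  = mk⇔ inj₁ [ (λ ()) , (λ ()) ]

module _ {V : Set} (v : V → Bool) where

  ⊨-∧ᶠ : ∀ φ ψ → v ⊨ (φ ∧ᶠ ψ) ⇔ (v ⊨ φ × v ⊨ ψ)
  ⊨-∧ᶠ _ _ = ∧-≡-true

  ⊨-∨ᶠ : ∀ φ ψ → v ⊨ (φ ∨ᶠ ψ) ⇔ (v ⊨ φ ⊎ v ⊨ ψ)
  ⊨-∨ᶠ _ _ = ∨-≡-true

  ⊨-⇒ᶠ : ∀ φ ψ → v ⊨ (φ ⇒ᶠ ψ) → v ⊨ φ → v ⊨ ψ
  ⊨-⇒ᶠ φ ψ h v⊨φ with ⟦ φ ⟧ v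
  ⊨-⇒ᶠ φ ψ h refl | true = h

  ⊨-⇔ᶠ : ∀ φ ψ → v ⊨ (φ ⇔ᶠ ψ) → (v ⊨ φ ⇔ v ⊨ ψ)
  ⊨-⇔ᶠ φ ψ h with ⟦ φ ⟧ v | ⟦ ψ ⟧ v
  ⊨-⇔ᶠ φ ψ h    | true  | true  = ⇔-refl
  ⊨-⇔ᶠ φ ψ h    | false | false = ⇔-refl
  ⊨-⇔ᶠ φ ψ ()   | true  | false
  ⊨-⇔ᶠ φ ψ ()   | false | true

  ⊨-⋀ : ∀ φs → v ⊨ ⋀ φs → All (v ⊨_) φs
  ⊨-⋀ []       _ = []
  ⊨-⋀ (φ ∷ φs) h with ⊨-∧ᶠ φ (⋀ φs) .to h
  ... | v⊨φ , v⊨φs = v⊨φ ∷ ⊨-⋀ φs v⊨φs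

  ⊨-⋁ : ∀ φs → v ⊨ ⋁ φs ⇔ Any (v ⊨_) φs
  ⊨-⋁ []       = mk⇔ (λ ()) (λ ())
  ⊨-⋁ (φ ∷ φs) = ⇔-trans (⊨-∨ᶠ φ (⋁ φs)) (mk⇔ [ here , there ∘ ⊨-⋁ φs .to ]
    λ { (here v⊨φ) → inj₁ v⊨φ ; (there v⊨φs) → inj₂ (⊨-⋁ φs .from v⊨φs) })

module _ {AP : Set} (M : Kripke AP) where

  ∈-post : ∀ {s s'} → s' ∈ post M s ⇔ R M s s' ≡ true
  ∈-post {s} = mk⇔ (λ s'∈ → T-≡ .to (proj₂ (∈-filter⁻ (T? ∘ R M s) {xs = allFin (n M)} s'∈)))
                   (λ edge → ∈-filter⁺ (T? ∘ R M s) (∈-allFin _) (T-≡ .from edge))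

  Any-post : ∀ {P : State M → Set} {s} → Any P (post M s) ⇔ (∃ λ s' → R M s s' ≡ true × P s')
  Any-post = mk⇔ (λ any → let (s' , s'∈ , Ps') = find any in s' , ∈-post .to s'∈ , Ps')
                 (λ (s' , edge , Ps') → lose (∈-post .from edge) Ps')

  ⊨-⋁-post : ∀ {V} (v : V → Bool) (φ : State M → Form V) {s} →
    v ⊨ ⋁ (map φ (post M s)) ⇔ (∃ λ s' → R M s s' ≡ true × v ⊨ φ s')
  ⊨-⋁-post v φ = ⇔-trans (⊨-⋁ v (map φ (post M _))) (⇔-trans (⇔-sym (↔⇒⇔ Any.map↔)) Any-post)

  _∧EX_ : (State M → Bool) → (State M → Set) → State M → Set
  (a ∧EX P) s = a s ≡ true × ∃ λ s' → R M s s' ≡ true × P s'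

  ∧EX-cong : ∀ {a P Q} → (∀ s → P s ⇔ Q s) → ∀ s → (a ∧EX P) s ⇔ (a ∧EX Q) s
  ∧EX-cong P⇔Q s = mk⇔ (λ (as , s' , edge , Ps') → as , s' , edge , P⇔Q s' .to Ps')
                       (λ (as , s' , edge , Qs') → as , s' , edge , P⇔Q s' .from Qs')

  singleton : State M → PathPrefix M
  singleton s = record { t = 0 ; st = λ _ → s ; step = λ () }

  prepend : ∀ s (p : PathPrefix M) → R M s (st p zero) ≡ true → PathPrefix M
  prepend s p edge = record
    { t    = suc (t p)
    ; st   = λ { zero → s ; (fsuc m) → st p m }
    ; step = λ { zero → edge ; (fsuc m) → step p m }
    }

  BoundedEU : (a b : State M → Bool) → ℕ → State M → Set
  BoundedEU a b k s = ∃ λ (p : PathPrefix M) → st p zero ≡ s × t p < k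
    × (∀ (m : Fin (t p)) → a (st p (inject₁ m)) ≡ true)
    × b (lastSt p) ≡ true

  module _ {a b : State M → Bool} where

    BoundedEU-mono : ∀ {k k' s} → k ≤ k' → BoundedEU a b k s → BoundedEU a b k' s
    BoundedEU-mono k≤k' (p , p₀ , t<k , ap , bp) = p , p₀ , ≤-trans t<k k≤k' , ap , bp

    BoundedEU-suc : ∀ {k s} → BoundedEU a b (suc k) s ⇔ (b s ≡ true ⊎ (a ∧EX BoundedEU a b k) s)
    BoundedEU-suc {k} = mk⇔ unfold fold
      where
      unfold : ∀ {s} → BoundedEU a b (suc k) s → b s ≡ true ⊎ (a ∧EX BoundedEU a b k) s
      unfold (record { t = zero } , refl , _ , _ , bp) = inj₁ bp
      unfold (record { t = suc t' ; st = f ; step = g } , refl , s≤s t'<k , ap , bp) =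
        inj₂ (ap zero , f (fsuc zero) , g zero
             , record { t = t' ; st = f ∘ fsuc ; step = g ∘ fsuc } , refl , t'<k , ap ∘ fsuc , bp)

      fold : ∀ {s} → b s ≡ true ⊎ (a ∧EX BoundedEU a b k) s → BoundedEU a b (suc k) s
      fold {s} (inj₁ bs) = singleton s , refl , s≤s z≤n , (λ ()) , bs
      fold {s} (inj₂ (as , _ , edge , p , refl , t<k , ap , bp)) =
        prepend s p edge , refl , s≤s t<k , (λ { zero → as ; (fsuc m) → ap m }) , bp

    BoundedEU-one : ∀ {s} → BoundedEU a b 1 s ⇔ b s ≡ true
    BoundedEU-one = ⇔-trans BoundedEU-suc (mk⇔ [ (λ bs → bs) , (λ { (_ , _ , _ , _ , _ , () , _) }) ] inj₁)

    BoundedEU-suc-suc : ∀ {k s} →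
      BoundedEU a b (suc (suc k)) s ⇔ (BoundedEU a b (suc k) s ⊎ (a ∧EX BoundedEU a b (suc k)) s)
    BoundedEU-suc-suc = mk⇔
      ([ inj₁ ∘ BoundedEU-suc .from ∘ inj₁ , inj₂ ] ∘ BoundedEU-suc .to)
      [ BoundedEU-mono (n≤1+n _) , BoundedEU-suc .from ∘ inj₂ ]

  record EUIteration (a b : State M → Bool) (Y : State M → ℕ → Bool) (N : ℕ) : Set where
    field
      start : ∀ s → Y s 1 ≡ true ⇔ b s ≡ true
      iterate : ∀ s k → k < N →
        Y s (suc (suc k)) ≡ true ⇔ (Y s (suc k) ≡ true ⊎ (a ∧EX λ s' → Y s' (suc k) ≡ true) s)

  EUIteration⇒BoundedEU : ∀ {a b Y N} → EUIteration a b Y N →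
    ∀ k → k ≤ N → ∀ s → Y s (suc k) ≡ true ⇔ BoundedEU a b (suc k) s
  EUIteration⇒BoundedEU {a} it zero _ s = ⇔-trans (EUIteration.start it s) (⇔-sym (BoundedEU-one {a}))
  EUIteration⇒BoundedEU {a} {b} {Y} it (suc k) k<N s = begin
    Y s (suc (suc k)) ≡ true
      ∼⟨ EUIteration.iterate it s k k<N ⟩
    (Y s (suc k) ≡ true ⊎ (a ∧EX λ s' → Y s' (suc k) ≡ true) s)
      ∼⟨ IH s ⊎-⇔ ∧EX-cong {a} IH s ⟩
    (BoundedEU a b (suc k) s ⊎ (a ∧EX BoundedEU a b (suc k)) s)
      ∼⟨ ⇔-sym (BoundedEU-suc-suc {a} {b}) ⟩
    BoundedEU a b (suc (suc k)) s ∎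
    where
    open EquationalReasoning
    IH : ∀ s → Y s (suc k) ≡ true ⇔ BoundedEU a b (suc k) s
    IH = EUIteration⇒BoundedEU it k (≤-trans (n≤1+n k) k<N)

  module _ (i j j' : ℕ) (v : Var (n M) → Bool) where

    euFormula-iteration : v ⊨ euFormula M i j j'
      → v (xEU i) ≡ true → v (l i j) ≡ true → v (r i j') ≡ true
      → EUIteration (λ s → v (y j s)) (λ s → v (y j' s)) (λ s k → v (yk i s k)) (n M)
    euFormula-iteration sat x-true l-true r-true = record { start = start ; iterate = iterate }
      where
      -- The conjuncts of the per-state clause of euFormula, which is local to its definition.
      Yᶠ : State M → ℕ → Form (Var (n M))
      Yᶠ s k = var (yk i s k)
      successorᶠ : State M → ℕ → Form (Var (n M))
      successorᶠ s k = var (y j s) ∧ᶠ ⋁ (map (λ s' → Yᶠ s' k) (post M s))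
      stepᶠ : State M → ℕ → Form (Var (n M))
      stepᶠ s k = Yᶠ s (suc (suc k)) ⇔ᶠ (Yᶠ s (suc k) ∨ᶠ successorᶠ s (suc k))
      baseᶠ : State M → Form (Var (n M))
      baseᶠ s = Yᶠ s 1 ⇔ᶠ var (y j' s)
      stepsᶠ : State M → Form (Var (n M))
      stepsᶠ s = ⋀ (map (stepᶠ s) (upTo (n M)))
      finalᶠ : State M → Form (Var (n M))
      finalᶠ s = var (y i s) ⇔ᶠ Yᶠ s (suc (n M))

      stateᶠ : State M → Form (Var (n M))
      stateᶠ s = baseᶠ s ∧ᶠ (stepsᶠ s ∧ᶠ finalᶠ s)

      clause : ∀ s → v ⊨ stateᶠ s
      clause s = lookup (All.map⁻ (⊨-⋀ v (map stateᶠ (allFin (n M))) clauses)) (∈-allFin s)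
        where
        premiseᶠ : Form (Var (n M))
        premiseᶠ = var (xEU i) ∧ᶠ (var (l i j) ∧ᶠ var (r i j'))
        premise : v ⊨ premiseᶠ
        premise = ∧-≡-true .from (x-true , ∧-≡-true .from (l-true , r-true))
        clauses : v ⊨ ⋀ (map stateᶠ (allFin (n M)))
        clauses = ⊨-⇒ᶠ v premiseᶠ (⋀ (map stateᶠ (allFin (n M)))) sat premise

      stepClause : ∀ s k → k < n M → v ⊨ stepᶠ s k
      stepClause s k k<N = lookup (All.map⁻ (⊨-⋀ v (map (stepᶠ s) (upTo (n M))) steps)) (∈-upTo⁺ k<N)
        where
        steps : v ⊨ stepsᶠ s
        steps = proj₁ (⊨-∧ᶠ v (stepsᶠ s) (finalᶠ s) .to
                  (proj₂ (⊨-∧ᶠ v (baseᶠ s) (stepsᶠ s ∧ᶠ finalᶠ s) .to (clause s))))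

      start : ∀ s → v (yk i s 1) ≡ true ⇔ v (y j' s) ≡ true
      start s = ⊨-⇔ᶠ v (Yᶠ s 1) (var (y j' s)) (proj₁ (⊨-∧ᶠ v (baseᶠ s) (stepsᶠ s ∧ᶠ finalᶠ s) .to (clause s)))

      iterate : ∀ s k → k < n M → v (yk i s (suc (suc k))) ≡ true ⇔
        (v (yk i s (suc k)) ≡ true ⊎ ((λ s → v (y j s)) ∧EX (λ s' → v (yk i s' (suc k)) ≡ true)) s)
      iterate s k k<N = begin
        v (yk i s (suc (suc k))) ≡ true
          ∼⟨ ⊨-⇔ᶠ v (Yᶠ s (suc (suc k))) (Yᶠ s (suc k) ∨ᶠ successorᶠ s (suc k)) (stepClause s k k<N) ⟩
        v ⊨ (Yᶠ s (suc k) ∨ᶠ successorᶠ s (suc k))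
          ∼⟨ ⊨-∨ᶠ v (Yᶠ s (suc k)) (successorᶠ s (suc k)) ⟩
        (v ⊨ Yᶠ s (suc k) ⊎ v ⊨ successorᶠ s (suc k))
          ∼⟨ ⇔-refl ⊎-⇔ ⇔-trans (⊨-∧ᶠ v (var (y j s)) (⋁ (map (λ s' → Yᶠ s' (suc k)) (post M s))))
                                (⇔-refl ×-⇔ ⊨-⋁-post v (λ s' → Yᶠ s' (suc k))) ⟩
        (v (yk i s (suc k)) ≡ true ⊎ ((λ s → v (y j s)) ∧EX (λ s' → v (yk i s' (suc k)) ≡ true)) s) ∎
        where open EquationalReasoning

lemma1 : ∀ {AP : Set} (M : Kripke AP) (i j j' : ℕ) (v : Var (n M) → Bool)
    → v ⊨ euFormula M i j j'
    → v (xEU i) ≡ true → v (l i j) ≡ true → v (r i j') ≡ true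
    → ∀ (s : Fin (n M)) (k : ℕ) → 1 ≤ k → k ≤ suc (n M)
    → (v (yk i s k) ≡ true)
      ⇔ (∃ λ (p : PathPrefix M) → st p zero ≡ s × t p < k
           × (∀ (m : Fin (t p)) → v (y j (st p (inject₁ m))) ≡ true)
           × v (y j' (lastSt p)) ≡ true)
lemma1 M i j j' v sat x-true l-true r-true s (suc k) (s≤s z≤n) (s≤s k≤|S|) =
  EUIteration⇒BoundedEU M (euFormula-iteration M i j j' v sat x-true l-true r-true) k k≤|S| s
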